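{- The proof system $\mathsf{C}(\ast)$ is sound: every formula derivable in $\mathsf{C}(\ast)$ is valid.
   Context: Logic $\mathrm{SL}(\ast,\mathrm{alloc})$: fix a countably infinite set $\mathrm{PVAR}$ of program variables and a countably infinite set $\mathrm{LOC}$ of locations. Formulae: $\varphi ::= x = y \mid x \hookrightarrow y \mid \mathrm{emp}\mid \mathrm{alloc}(x) \mid \neg\varphi \mid \varphi\wedge\varphi \mid \varphi \ast \varphi$ ($x,y\in\mathrm{PVAR}$). Memory states $(s,h)$: $s:\mathrm{PVAR}\to\mathrm{LOC}$, $h$ a partial function $\mathrm{LOC}\to\mathrm{LOC}$ with finite domain. $(s,h)\models x=y$ iff $s(x)=s(y)$; $\models\mathrm{emp}$ iff $\mathrm{dom}(h)=\emptyset$; $\models x\hookrightarrow y$ iff $s(x)\in\mathrm{dom}(h)$ and $h(s(x))=s(y)$; $\models\mathrm{alloc}(x)$ iff $s(x)\in\mathrm{dom}(h)$; Boolean connectives as usual; $\models\varphi_1\ast\varphi_2$ iff $h$ splits into two domain-disjoint heaps $h_1,h_2$ ($h=h_1+h_2$) with $(s,h_i)\models\varphi_i$. Valid = satisfied by all memory states. Abbreviations: $\bot:=\neg(x=x)$, $\top:=\neg\bot$, $\mathrm{size}\ge0:=\top$, $\mathrm{size}\ge1:=\neg\mathrm{emp}$, $\mathrm{size}\ge\beta:=\neg\mathrm{emp}\ast\mathrm{size}\ge\beta-1$ for $\beta\ge2$; $\mathrm{size}=\beta:=\mathrm{size}\ge\beta\wedge\neg\,\mathrm{size}\ge\beta+1$;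 $a\dot-b=\max(0,a-b)$. The proof system $\mathsf{C}(\ast)$ (derivability is the least set of formulae containing all instances of the axiom schemata, metavariables ranging over formulae, variables, naturals and finite sets of variables, and closed under the rules) consists of all axiom schemata of classical propositional calculus, modus ponens, and: (1) $x=x$; (2) $\varphi\wedge x=y\Rightarrow\varphi'$, where $\varphi'$ is obtained from $\varphi$ by replacing every occurrence of $y$ with $x$; (3) $x\hookrightarrow y\Rightarrow\mathrm{alloc}(x)$; (4) $(x\hookrightarrow y\wedge x\hookrightarrow z)\Rightarrow y=z$; (5) $\mathrm{size}\ge\beta+1\Rightarrow\mathrm{size}\ge\beta$; (6) $\bigwedge_{x\in X}(\mathrm{alloc}(x)\wedge\bigwedge_{y\in X\setminus\{x\}}\neg(x=y))\Rightarrow\mathrm{size}\ge|X|$ for finite $X$; (7) $(\varphi\ast\psi)\Leftrightarrow(\psi\ast\varphi)$; (8) $((\varphi\ast\psi)\ast\chi)\Leftrightarrow(\varphi\ast(\psi\ast\chi))$; (9) $((\varphi\vee\psi)\ast\chi)\Rightarrow((\varphi\ast\chi)\vee(\psi\ast\chi))$; (10) $(\bot\ast\varphi)\Leftrightarrow\bot$; (11) $\varphi\Leftrightarrow(\varphi\ast\mathrm{emp})$; (12) $(\mathrm{alloc}(x)\ast\top)\Rightarrow\mathrm{alloc}(x)$; (13) $(\mathrm{alloc}(x)\ast\mathrm{alloc}(x))\Leftrightarrow\bot$; (14) $(\xi\ast\top)\Rightarrow\xi$ for $\xi\in\{\neg\mathrm{emp},\ x=y,\ \neg(x=y),\ x\hookrightarrow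 y\}$; (15) $(\neg\mathrm{alloc}(x)\ast\neg\mathrm{alloc}(x))\Rightarrow\neg\mathrm{alloc}(x)$; (16) $((\mathrm{alloc}(x)\wedge\neg x\hookrightarrow y)\ast\top)\Rightarrow\neg x\hookrightarrow y$; (17) $\mathrm{alloc}(x)\Rightarrow((\mathrm{alloc}(x)\wedge\mathrm{size}=1)\ast\top)$; (18) $\neg\mathrm{emp}\Rightarrow(\mathrm{size}=1\ast\top)$; (19) $(\neg\,\mathrm{size}\ge\beta_1\ast\neg\,\mathrm{size}\ge\beta_2)\Rightarrow\neg\,\mathrm{size}\ge\beta_1+\beta_2\dot-1$; (20) $(\mathrm{alloc}(x)\wedge\mathrm{alloc}(y)\wedge\neg(x=y))\Rightarrow\mathrm{size}\ge2$; and the rule: from $\varphi\Rightarrow\chi$ infer $(\varphi\ast\psi)\Rightarrow(\chi\ast\psi)$. -}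

module Defs where

open import Data.Nat using (ℕ; zero; suc; _+_; _∸_)
open import Data.Nat.Properties using (_≟_)
open import Data.Bool using (Bool; true; false; not; _∧_)
open import Data.Maybe using (Maybe; just; nothing)
open import Data.List using (List; []; _∷_; foldr; filter; length)
open import Data.List.Membership.Propositional using (_∈_)
open import Data.List.Relation.Unary.Unique.Propositional using (Unique)
open import Data.Product using (Σ; ∃; _×_; _,_)
open import Data.Sum using (_⊎_)
open import Relation.Binary.PropositionalEquality using (_≡_; _≢_)
open import Relation.Nullary using (¬_; yes; no)
open import Relation.Nullary.Decidable using (¬?)

PVar : Set
PVar = ℕ

Loc : Set
Loc = ℕ

infix 9 _`=_ _↪_
infix 8 `¬_
infixr 6 _`∧_
infixr 5 _`∗_
infixr 4 _`∨_
infixr 3 _⇒_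
infix 2 _⇔_

data Form : Set where
  _`=_   : PVar → PVar → Form
  _↪_    : PVar → PVar → Form
  emp    : Form
  alloc  : PVar → Form
  `¬_    : Form → Form
  _`∧_   : Form → Form → Form
  _`∗_   : Form → Form → Form

_`∨_ : Form → Form → Form
φ `∨ ψ = `¬ (`¬ φ `∧ `¬ ψ)

_⇒_ : Form → Form → Form
φ ⇒ ψ = `¬ (φ `∧ `¬ ψ)

_⇔_ : Form → Form → Form
φ ⇔ ψ = (φ ⇒ ψ) `∧ (ψ ⇒ φ)

`⊥ : Form
`⊥ = `¬ (0 `= 0)

`⊤ : Form
`⊤ = `¬ `⊥

size≥ : ℕ → Form
size≥ zero = `⊤
size≥ (suc zero) = `¬ emp
size≥ (suc (suc β)) = `¬ emp `∗ size≥ (suc β)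

size≡ : ℕ → Form
size≡ β = size≥ β `∧ `¬ size≥ (suc β)

⋀ : List Form → Form
⋀ = foldr _`∧_ `⊤

renameVar : PVar → PVar → PVar → PVar
renameVar y x z with z ≟ y
... | yes _ = x
... | no  _ = z

replace : PVar → PVar → Form → Form
replace y x (a `= b) = renameVar y x a `= renameVar y x b
replace y x (a ↪ b)  = renameVar y x a ↪ renameVar y x b
replace y x emp      = emp
replace y x (alloc a) = alloc (renameVar y x a)
replace y x (`¬ φ)   = `¬ replace y x φ
replace y x (φ `∧ ψ) = replace y x φ `∧ replace y x ψ
replace y x (φ `∗ ψ) = replace y x φ `∗ replace y x ψ

-- Classical propositional calculus: all instances of propositional
-- tautologies (built from atoms, ¬ and ∧).

data PForm : Set where
  atom : ℕ → PForm
  p¬   : PForm → PForm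
  p∧   : PForm → PForm → PForm

evalP : (ℕ → Bool) → PForm → Bool
evalP v (atom n) = v n
evalP v (p¬ p)   = not (evalP v p)
evalP v (p∧ p q) = evalP v p ∧ evalP v q

Tautology : PForm → Set
Tautology p = (v : ℕ → Bool) → evalP v p ≡ true

instP : (ℕ → Form) → PForm → Form
instP σ (atom n) = σ n
instP σ (p¬ p)   = `¬ instP σ p
instP σ (p∧ p q) = instP σ p `∧ instP σ q

-- Axiom (6): for a finite set X of variables (a duplicate-free list)

distinctAlloc : List PVar → Form
distinctAlloc X =
  ⋀ (Data.List.map
       (λ x → alloc x `∧ ⋀ (Data.List.map (λ y → `¬ (x `= y))
                                           (filter (λ y → ¬? (y ≟ x)) X)))
       X)

data Derivable : Form → Set where
  taut   : (p : PForm) → Tautology p → (σ : ℕ → Form) → Derivable (instP σ p)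
  mp     : {φ ψ : Form} → Derivable φ → Derivable (φ ⇒ ψ) → Derivable ψ
  ax1    : (x : PVar) → Derivable (x `= x)
  ax2    : (φ : Form) (x y : PVar) → Derivable ((φ `∧ (x `= y)) ⇒ replace y x φ)
  ax3    : (x y : PVar) → Derivable ((x ↪ y) ⇒ alloc x)
  ax4    : (x y z : PVar) → Derivable (((x ↪ y) `∧ (x ↪ z)) ⇒ (y `= z))
  ax5    : (β : ℕ) → Derivable (size≥ (suc β) ⇒ size≥ β)
  ax6    : (X : List PVar) → Unique X → Derivable (distinctAlloc X ⇒ size≥ (length X))
  ax7    : (φ ψ : Form) → Derivable ((φ `∗ ψ) ⇔ (ψ `∗ φ))
  ax8    : (φ ψ χ : Form) → Derivable (((φ `∗ ψ) `∗ χ) ⇔ (φ `∗ (ψ `∗ χ)))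
  ax9    : (φ ψ χ : Form) → Derivable (((φ `∨ ψ) `∗ χ) ⇒ ((φ `∗ χ) `∨ (ψ `∗ χ)))
  ax10   : (φ : Form) → Derivable ((`⊥ `∗ φ) ⇔ `⊥)
  ax11   : (φ : Form) → Derivable (φ ⇔ (φ `∗ emp))
  ax12   : (x : PVar) → Derivable ((alloc x `∗ `⊤) ⇒ alloc x)
  ax13   : (x : PVar) → Derivable ((alloc x `∗ alloc x) ⇔ `⊥)
  ax14a  : Derivable ((`¬ emp `∗ `⊤) ⇒ `¬ emp)
  ax14b  : (x y : PVar) → Derivable (((x `= y) `∗ `⊤) ⇒ (x `= y))
  ax14c  : (x y : PVar) → Derivable ((`¬ (x `= y) `∗ `⊤) ⇒ `¬ (x `= y))
  ax14d  : (x y : PVar) → Derivable (((x ↪ y) `∗ `⊤) ⇒ (x ↪ y))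
  ax15   : (x : PVar) → Derivable ((`¬ alloc x `∗ `¬ alloc x) ⇒ `¬ alloc x)
  ax16   : (x y : PVar) → Derivable (((alloc x `∧ `¬ (x ↪ y)) `∗ `⊤) ⇒ `¬ (x ↪ y))
  ax17   : (x : PVar) → Derivable (alloc x ⇒ ((alloc x `∧ size≡ 1) `∗ `⊤))
  ax18   : Derivable (`¬ emp ⇒ (size≡ 1 `∗ `⊤))
  ax19   : (β₁ β₂ : ℕ) →
           Derivable ((`¬ size≥ β₁ `∗ `¬ size≥ β₂) ⇒ `¬ size≥ ((β₁ + β₂) ∸ 1))
  ax20   : (x y : PVar) →
           Derivable ((alloc x `∧ alloc y `∧ `¬ (x `= y)) ⇒ size≥ 2)
  ∗-intro : {φ χ : Form} (ψ : Form) → Derivable (φ ⇒ χ) →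
            Derivable ((φ `∗ ψ) ⇒ (χ `∗ ψ))

Store : Set
Store = PVar → Loc

record Heap : Set where
  field
    _⟨_⟩  : Loc → Maybe Loc
    finite : ∃ λ (L : List Loc) → ∀ l → _⟨_⟩ l ≢ nothing → l ∈ L
open Heap public

_≔_+_ : Heap → Heap → Heap → Set
h ≔ h₁ + h₂ = ∀ l → (h₁ ⟨ l ⟩ ≡ nothing × h ⟨ l ⟩ ≡ h₂ ⟨ l ⟩)
                  ⊎ (h₂ ⟨ l ⟩ ≡ nothing × h ⟨ l ⟩ ≡ h₁ ⟨ l ⟩)

_,_⊨_ : Store → Heap → Form → Set
s , h ⊨ (x `= y)  = s x ≡ s y
s , h ⊨ (x ↪ y)   = h ⟨ s x ⟩ ≡ just (s y)
s , h ⊨ emp       = ∀ l → h ⟨ l ⟩ ≡ nothing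
s , h ⊨ alloc x   = ∃ λ v → h ⟨ s x ⟩ ≡ just v
s , h ⊨ (`¬ φ)    = ¬ (s , h ⊨ φ)
s , h ⊨ (φ `∧ ψ)  = (s , h ⊨ φ) × (s , h ⊨ ψ)
s , h ⊨ (φ `∗ ψ)  = Σ Heap λ h₁ → Σ Heap λ h₂ →
                      (h ≔ h₁ + h₂) × (s , h₁ ⊨ φ) × (s , h₂ ⊨ ψ)

Valid : Form → Set
Valid φ = (s : Store) (h : Heap) → s , h ⊨ φ

module Submission where

-- The semantics is constructive, so the propositional parts of C(∗)
-- (tautologies, modus ponens, the frame rule) are sound only because
-- satisfaction is decidable, hence stable under double negation.
-- Decidability of φ ∗ ψ rests on finiteness: up to pointwise equality
-- of heaps, every split of h restricts h to a sublist of its (finite)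
-- domain and to the complement, so only finitely many splits matter.

open import Defs
open import Data.Nat using (ℕ; zero; suc; _+_; _∸_; _≤_; z≤n; s≤s)
open import Data.Nat.Properties using (_≟_; +-suc; +-mono-≤; ≤-trans; ≤-refl; n≤1+n; n≮n; ≤-reflexive; ≰⇒>)
open import Data.Bool using (Bool; true; false; not; _∧_; if_then_else_)
open import Data.Maybe using (Maybe; just; nothing; _<∣>_)
import Data.Maybe.Properties as Maybe
open import Data.List using (List; []; _∷_; _++_; map; filter; length)
open import Data.List.Properties using (length-map; length-++)
open import Data.List.Membership.Propositional using (_∈_; _∉_; lose)
open import Data.List.Membership.Propositional.Properties using (∈-filter⁺; ∈-filter⁻; ∈-++⁺ˡ; ∈-++⁺ʳ; ∈-map⁺)
open import Data.List.Membership.DecPropositional _≟_ using (_∈?_)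
open import Data.List.Relation.Unary.Any using (here; there; any?; satisfied)
open import Data.List.Relation.Unary.All using (All; []; _∷_)
import Data.List.Relation.Unary.All as All
import Data.List.Relation.Unary.All.Properties as All
open import Data.List.Relation.Unary.AllPairs using ([]; _∷_)
open import Data.List.Relation.Unary.Unique.Propositional using (Unique)
import Data.List.Relation.Unary.Unique.Propositional.Properties as Unique
open import Data.List.Relation.Binary.Disjoint.Propositional using (Disjoint)
open import Data.Product using (Σ; ∃; ∃₂; _×_; _,_; proj₁; proj₂)
open import Data.Sum using (_⊎_; inj₁; inj₂)
import Data.Sum as Sum
open import Data.Empty using (⊥-elim)
open import Function using (_∘_)
open import Relation.Binary.PropositionalEquality using (_≡_; _≢_; refl; sym; trans; cong; cong₂; subst; subst₂)
open import Relation.Nullary using (¬_; Dec; yes; no; does)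
open import Relation.Nullary.Decidable using (¬?; _×-dec_)

just≢nothing : ∀ {v : Loc} → just v ≢ nothing
just≢nothing ()

does-true : {A : Set} (a? : Dec A) → does a? ≡ true → A
does-true (yes a) _ = a
does-true (no _) ()

-- Pointwise equality of heaps; satisfaction only sees heaps up to it.
_≐_ : Heap → Heap → Set
h ≐ h′ = ∀ l → h ⟨ l ⟩ ≡ h′ ⟨ l ⟩

-- A finite list of locations that contains the domain of h.
dom : Heap → List Loc
dom h = proj₁ (finite h)

dom-complete : (h : Heap) (l : Loc) → h ⟨ l ⟩ ≢ nothing → l ∈ dom h
dom-complete h = proj₂ (finite h)

Alloc : Heap → Loc → Set
Alloc h l = ∃ λ v → h ⟨ l ⟩ ≡ just v

alloc? : (h : Heap) (l : Loc) → Dec (Alloc h l)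
alloc? h l with h ⟨ l ⟩
... | just v  = yes (v , refl)
... | nothing = no λ ()

-- Stated for the contents m = h ⟨ l ⟩ of a cell, so that it is inferable.
alloc⇒defined : {m : Maybe Loc} → (∃ λ v → m ≡ just v) → m ≢ nothing
alloc⇒defined (v , e) e′ = just≢nothing (trans (sym e) e′)

Empty : Heap → Set
Empty h = ∀ l → h ⟨ l ⟩ ≡ nothing

-- Because the domain is finite, a heap is empty or exhibits an allocated
-- location; this gives both decidability of emp and witnesses for ¬ emp.
empty-or-allocated : (h : Heap) → Empty h ⊎ ∃ (Alloc h)
empty-or-allocated h with any? (alloc? h) (dom h)
... | yes some = inj₂ (satisfied some)
... | no none  = inj₁ unallocated
  where
  unallocated : Empty h
  unallocated l with h ⟨ l ⟩ in eq
  ... | nothing = refl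
  ... | just v  = ⊥-elim (none (lose (dom-complete h l (alloc⇒defined (v , eq))) (v , eq)))

allocated⇒nonempty : ∀ h l → Alloc h l → ¬ Empty h
allocated⇒nonempty h l a empty = alloc⇒defined a (empty l)

empty? : (h : Heap) → Dec (Empty h)
empty? h with empty-or-allocated h
... | inj₁ empty   = yes empty
... | inj₂ (l , a) = no (allocated⇒nonempty h l a)

nonempty⇒allocated : (h : Heap) → ¬ Empty h → ∃ (Alloc h)
nonempty⇒allocated h nonempty with empty-or-allocated h
... | inj₁ empty     = ⊥-elim (nonempty empty)
... | inj₂ allocated = allocated

emptyHeap : Heap
emptyHeap = record { _⟨_⟩ = λ _ → nothing ; finite = [] , λ l undefined → ⊥-elim (undefined refl) }

SplitAt : Heap → Heap → Heap → Loc → Set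
SplitAt h h₁ h₂ l = (h₁ ⟨ l ⟩ ≡ nothing × h ⟨ l ⟩ ≡ h₂ ⟨ l ⟩)
                  ⊎ (h₂ ⟨ l ⟩ ≡ nothing × h ⟨ l ⟩ ≡ h₁ ⟨ l ⟩)

-- Pointwise consequences of a split.  The heaps are explicit parameters
-- since they cannot be inferred from the split itself.
module Split (h h₁ h₂ : Heap) (split : h ≔ h₁ + h₂) where

  swap : h ≔ h₂ + h₁
  swap l = Sum.swap (split l)

  left : ∀ {l v} → h₁ ⟨ l ⟩ ≡ just v → h ⟨ l ⟩ ≡ just v
  left {l} e with split l
  ... | inj₁ (e₁ , _) = ⊥-elim (just≢nothing (trans (sym e) e₁))
  ... | inj₂ (_ , e₂) = trans e₂ e

  disjoint : ∀ {l v} → h₁ ⟨ l ⟩ ≡ just v → h₂ ⟨ l ⟩ ≡ nothing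
  disjoint {l} e with split l
  ... | inj₁ (e₁ , _) = ⊥-elim (just≢nothing (trans (sym e) e₁))
  ... | inj₂ (e₂ , _) = e₂

  cases : ∀ {l v} → h ⟨ l ⟩ ≡ just v → h₁ ⟨ l ⟩ ≡ just v ⊎ h₂ ⟨ l ⟩ ≡ just v
  cases {l} e with split l
  ... | inj₁ (_ , e₂) = inj₂ (trans (sym e₂) e)
  ... | inj₂ (_ , e₁) = inj₁ (trans (sym e₁) e)

  off-left : ∀ {l} → h₁ ⟨ l ⟩ ≡ nothing → h ⟨ l ⟩ ≡ h₂ ⟨ l ⟩
  off-left {l} e₁ with split l
  ... | inj₁ (_ , e)  = e
  ... | inj₂ (e₂ , e) = trans e (trans e₁ (sym e₂))

  empty-left : Empty h → Empty h₁
  empty-left empty l with split l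
  ... | inj₁ (e₁ , _) = e₁
  ... | inj₂ (_ , e)  = trans (sym e) (empty l)

split-resp-≐ : ∀ h h′ h₁ h₂ → h ≐ h′ → h ≔ h₁ + h₂ → h′ ≔ h₁ + h₂
split-resp-≐ h h′ h₁ h₂ h≐h′ split l = Sum.map (λ (e₁ , e) → e₁ , trans (sym (h≐h′ l)) e)
                                    (λ (e₂ , e) → e₂ , trans (sym (h≐h′ l)) e) (split l)

_∪_ : Heap → Heap → Heap
h₁ ∪ h₂ = record { _⟨_⟩ = λ l → h₁ ⟨ l ⟩ <∣> h₂ ⟨ l ⟩ ; finite = dom h₁ ++ dom h₂ , covered }
  where
  covered : ∀ l → h₁ ⟨ l ⟩ <∣> h₂ ⟨ l ⟩ ≢ nothing → l ∈ dom h₁ ++ dom h₂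
  covered l defined with h₁ ⟨ l ⟩ in eq
  ... | just v  = ∈-++⁺ˡ (dom-complete h₁ l (alloc⇒defined (v , eq)))
  ... | nothing = ∈-++⁺ʳ (dom h₁) (dom-complete h₂ l defined)

∪-off-left : (h₁ h₂ : Heap) {l : Loc} → h₁ ⟨ l ⟩ ≡ nothing → (h₁ ∪ h₂) ⟨ l ⟩ ≡ h₂ ⟨ l ⟩
∪-off-left h₁ h₂ e rewrite e = refl

∪-off-right : (h₁ h₂ : Heap) {l : Loc} → h₂ ⟨ l ⟩ ≡ nothing → (h₁ ∪ h₂) ⟨ l ⟩ ≡ h₁ ⟨ l ⟩
∪-off-right h₁ h₂ {l} e with h₁ ⟨ l ⟩
... | just v  = refl
... | nothing = e

split-assoc : ∀ h h₁₂ h₁ h₂ h₃ → h ≔ h₁₂ + h₃ → h₁₂ ≔ h₁ + h₂ →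
              (h ≔ h₁ + (h₂ ∪ h₃)) × ((h₂ ∪ h₃) ≔ h₂ + h₃)
split-assoc h h₁₂ h₁ h₂ h₃ outer inner =
  (λ l → proj₁ (at l (outer l) (inner l))) , (λ l → proj₂ (at l (outer l) (inner l)))
  where
  at : ∀ l → SplitAt h h₁₂ h₃ l → SplitAt h₁₂ h₁ h₂ l →
       SplitAt h h₁ (h₂ ∪ h₃) l × SplitAt (h₂ ∪ h₃) h₂ h₃ l
  at l (inj₁ (n₁₂ , e)) (inj₁ (n₁ , e₁₂)) =
    inj₁ (n₁ , trans e (sym (∪-off-left h₂ h₃ n₂))) , inj₁ (n₂ , ∪-off-left h₂ h₃ n₂)
    where n₂ = trans (sym e₁₂) n₁₂
  at l (inj₁ (n₁₂ , e)) (inj₂ (n₂ , e₁₂)) =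
    inj₁ (trans (sym e₁₂) n₁₂ , trans e (sym (∪-off-left h₂ h₃ n₂))) , inj₁ (n₂ , ∪-off-left h₂ h₃ n₂)
  at l (inj₂ (n₃ , e)) (inj₁ (n₁ , e₁₂)) =
    inj₁ (n₁ , trans e (trans e₁₂ (sym (∪-off-right h₂ h₃ n₃)))) , inj₂ (n₃ , ∪-off-right h₂ h₃ n₃)
  at l (inj₂ (n₃ , e)) (inj₂ (n₂ , e₁₂)) =
    inj₂ (trans (∪-off-left h₂ h₃ n₂) n₃ , trans e e₁₂) , inj₁ (n₂ , ∪-off-left h₂ h₃ n₂)

within : Heap → (Loc → Bool) → Heap
within h keep = record { _⟨_⟩ = λ l → if keep l then h ⟨ l ⟩ else nothing ; finite = dom h , covered }
  where
  covered : ∀ l → (if keep l then h ⟨ l ⟩ else nothing) ≢ nothing → l ∈ dom h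
  covered l defined with keep l
  ... | true  = dom-complete h l defined
  ... | false = ⊥-elim (defined refl)

within-split : (h : Heap) (keep : Loc → Bool) → h ≔ within h keep + within h (not ∘ keep)
within-split h keep l with keep l
... | true  = inj₂ (refl , refl)
... | false = inj₁ (refl , refl)

restrict restrictᶜ : Heap → List Loc → Heap
restrict  h S = within h (λ l → does (l ∈? S))
restrictᶜ h S = within h (not ∘ λ l → does (l ∈? S))

restrict-split : (h : Heap) (S : List Loc) → h ≔ restrict h S + restrictᶜ h S
restrict-split h S = within-split h (λ l → does (l ∈? S))

restrict-∈ : (h : Heap) (S : List Loc) {l : Loc} → l ∈ S → restrict h S ⟨ l ⟩ ≡ h ⟨ l ⟩
restrict-∈ h S {l} l∈S with l ∈? S
... | yes _   = refl
... | no l∉S = ⊥-elim (l∉S l∈S)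

restrictᶜ-∉ : (h : Heap) (S : List Loc) {l : Loc} → l ∉ S → restrictᶜ h S ⟨ l ⟩ ≡ h ⟨ l ⟩
restrictᶜ-∉ h S {l} l∉S with l ∈? S
... | yes l∈S = ⊥-elim (l∉S l∈S)
... | no _    = refl

restrict-alloc : (h : Heap) (S : List Loc) {l : Loc} → Alloc (restrict h S) l → l ∈ S
restrict-alloc h S {l} a with l ∈? S
... | yes l∈S = l∈S
... | no _    = ⊥-elim (alloc⇒defined a refl)

-- All sublists of a list; finitely many candidates for a split.
sublists : {A : Set} → List A → List (List A)
sublists []       = [] ∷ []
sublists (x ∷ xs) = map (x ∷_) (sublists xs) ++ sublists xs

filter∈sublists : {A : Set} {P : A → Set} (P? : ∀ x → Dec (P x)) (xs : List A) →
                  filter P? xs ∈ sublists xs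
filter∈sublists P? []       = here refl
filter∈sublists P? (x ∷ xs) with does (P? x)
... | true  = ∈-++⁺ˡ (∈-map⁺ (x ∷_) (filter∈sublists P? xs))
... | false = ∈-++⁺ʳ (map (x ∷_) (sublists xs)) (filter∈sublists P? xs)

-- Every split of h is, up to ≐, a restriction of h to a sublist S of
-- dom h together with the complement (take S = the part of dom h in h₁).
split-is-restriction : ∀ h h₁ h₂ → h ≔ h₁ + h₂ →
  ∃ λ S → S ∈ sublists (dom h) × h₁ ≐ restrict h S × h₂ ≐ restrictᶜ h S
split-is-restriction h h₁ h₂ split = S , filter∈sublists (alloc? h₁) (dom h) , left-part , right-part
  where
  open Split h h₁ h₂ split

  S : List Loc
  S = filter (alloc? h₁) (dom h)

  outside : ∀ {l} → l ∉ S → h₁ ⟨ l ⟩ ≡ nothing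
  outside {l} l∉S with h₁ ⟨ l ⟩ in eq
  ... | nothing = refl
  ... | just v  = ⊥-elim (l∉S (∈-filter⁺ (alloc? h₁) (dom-complete h l (alloc⇒defined (v , left eq))) (v , eq)))

  left-part : h₁ ≐ restrict h S
  left-part l with l ∈? S
  ... | yes l∈S = let (v , e) = proj₂ (∈-filter⁻ (alloc? h₁) {xs = dom h} l∈S) in trans e (sym (left e))
  ... | no l∉S  = outside l∉S

  right-part : h₂ ≐ restrictᶜ h S
  right-part l with l ∈? S
  ... | yes l∈S = disjoint (proj₂ (proj₂ (∈-filter⁻ (alloc? h₁) {xs = dom h} l∈S)))
  ... | no l∉S  = sym (off-left (outside l∉S))

Resp≐ : (Heap → Set) → Set
Resp≐ A = ∀ {h h′} → h ≐ h′ → A h → A h′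

⊨-resp-≐ : ∀ φ s → Resp≐ (λ h → s , h ⊨ φ)
⊨-resp-≐ (x `= y)  s h≐h′ p                           = p
⊨-resp-≐ (x ↪ y)   s h≐h′ p                           = trans (sym (h≐h′ (s x))) p
⊨-resp-≐ emp       s h≐h′ empty l                     = trans (sym (h≐h′ l)) (empty l)
⊨-resp-≐ (alloc x) s h≐h′ (v , e)                     = v , trans (sym (h≐h′ (s x))) e
⊨-resp-≐ (`¬ φ)    s h≐h′ ¬p q                        = ¬p (⊨-resp-≐ φ s (sym ∘ h≐h′) q)
⊨-resp-≐ (φ `∧ ψ)  s h≐h′ (p , q)                     = ⊨-resp-≐ φ s h≐h′ p , ⊨-resp-≐ ψ s h≐h′ q
⊨-resp-≐ (φ `∗ ψ)  s {h} {h′} h≐h′ (h₁ , h₂ , split , p , q) = h₁ , h₂ , split-resp-≐ h h′ h₁ h₂ h≐h′ split , p , q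

_⊛_ : (Heap → Set) → (Heap → Set) → Heap → Set
(A ⊛ B) h = Σ Heap λ h₁ → Σ Heap λ h₂ → (h ≔ h₁ + h₂) × A h₁ × B h₂

-- Decidable, ≐-invariant predicates are closed under ⊛: it suffices to try
-- the restrictions of h to the finitely many sublists of dom h.
⊛-dec : {A B : Heap → Set} → (∀ h → Dec (A h)) → (∀ h → Dec (B h)) →
        Resp≐ A → Resp≐ B → ∀ h → Dec ((A ⊛ B) h)
⊛-dec A? B? A-resp B-resp h
  with any? (λ S → A? (restrict h S) ×-dec B? (restrictᶜ h S)) (sublists (dom h))
... | yes found = let (S , a , b) = satisfied found in
                  yes (restrict h S , restrictᶜ h S , restrict-split h S , a , b)
... | no none   = no λ (h₁ , h₂ , split , a , b) →
                  let (S , S∈ , e₁ , e₂) = split-is-restriction h h₁ h₂ split in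
                  none (lose S∈ (A-resp e₁ a , B-resp e₂ b))

⊨-dec : ∀ φ s h → Dec (s , h ⊨ φ)
⊨-dec (x `= y)  s h = s x ≟ s y
⊨-dec (x ↪ y)   s h = Maybe.≡-dec _≟_ (h ⟨ s x ⟩) (just (s y))
⊨-dec emp       s h = empty? h
⊨-dec (alloc x) s h = alloc? h (s x)
⊨-dec (`¬ φ)    s h = ¬? (⊨-dec φ s h)
⊨-dec (φ `∧ ψ)  s h = ⊨-dec φ s h ×-dec ⊨-dec ψ s h
⊨-dec (φ `∗ ψ)  s h = ⊛-dec (⊨-dec φ s) (⊨-dec ψ s) (⊨-resp-≐ φ s) (⊨-resp-≐ ψ s) h

⊨-stable : ∀ φ s h → ¬ ¬ (s , h ⊨ φ) → s , h ⊨ φ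
⊨-stable φ s h ¬¬p with ⊨-dec φ s h
... | yes p = p
... | no ¬p = ⊥-elim (¬¬p ¬p)

-- φ ⊫ ψ: every model of φ is a model of ψ.  A record, so that φ and ψ
-- are determined by its type.
infix 1 _⊫_
record _⊫_ (φ ψ : Form) : Set where
  constructor entails
  field apply : ∀ s h → s , h ⊨ φ → s , h ⊨ ψ
open _⊫_

valid-⇒ : ∀ {φ ψ} → φ ⊫ ψ → Valid (φ ⇒ ψ)
valid-⇒ φ⊫ψ s h (p , ¬q) = ¬q (apply φ⊫ψ s h p)

valid-⇔ : ∀ {φ ψ} → φ ⊫ ψ → ψ ⊫ φ → Valid (φ ⇔ ψ)
valid-⇔ φ⊫ψ ψ⊫φ s h = valid-⇒ φ⊫ψ s h , valid-⇒ ψ⊫φ s h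

-- The converse needs stability of ψ.
⇒-entails : ∀ φ ψ → Valid (φ ⇒ ψ) → φ ⊫ ψ
⇒-entails φ ψ φ⇒ψ = entails λ s h p → ⊨-stable ψ s h λ ¬q → φ⇒ψ s h (p , ¬q)

ex-falso : ∀ φ → `⊥ ⊫ φ
ex-falso φ = entails λ s h ¬refl → ⊥-elim (¬refl refl)

∗-comm : ∀ φ ψ → (φ `∗ ψ) ⊫ (ψ `∗ φ)
∗-comm φ ψ = entails λ s h (h₁ , h₂ , split , p , q) → h₂ , h₁ , Split.swap h h₁ h₂ split , q , p

∗-assoc : ∀ φ ψ χ → ((φ `∗ ψ) `∗ χ) ⊫ (φ `∗ (ψ `∗ χ))
∗-assoc φ ψ χ = entails λ s h (h₁₂ , h₃ , outer , (h₁ , h₂ , inner , p , q) , r) →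
  let (split₁ , split₂₃) = split-assoc h h₁₂ h₁ h₂ h₃ outer inner in
  h₁ , h₂ ∪ h₃ , split₁ , p , h₂ , h₃ , split₂₃ , q , r

∗-assoc⁻¹ : ∀ φ ψ χ → (φ `∗ (ψ `∗ χ)) ⊫ ((φ `∗ ψ) `∗ χ)
∗-assoc⁻¹ φ ψ χ = entails λ s h →
  apply (∗-comm χ (φ `∗ ψ)) s h ∘ apply (∗-assoc χ φ ψ) s h ∘ apply (∗-comm ψ (χ `∗ φ)) s h ∘
  apply (∗-assoc ψ χ φ) s h ∘ apply (∗-comm φ (ψ `∗ χ)) s h

∗-distrib-∨ : ∀ φ ψ χ → ((φ `∨ ψ) `∗ χ) ⊫ ((φ `∗ χ) `∨ (ψ `∗ χ))
∗-distrib-∨ φ ψ χ = entails λ s h (h₁ , h₂ , split , φ∨ψ , r) (¬φχ , ¬ψχ) →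
  φ∨ψ ((λ p → ¬φχ (h₁ , h₂ , split , p , r)) , (λ q → ¬ψχ (h₁ , h₂ , split , q , r)))

⊥-∗ : ∀ φ → (`⊥ `∗ φ) ⊫ `⊥
⊥-∗ φ = entails λ s h (_ , _ , _ , ¬refl , _) → ¬refl

∗-emp-intro : ∀ φ → φ ⊫ (φ `∗ emp)
∗-emp-intro φ = entails λ s h p → h , emptyHeap , (λ l → inj₂ (refl , refl)) , p , (λ l → refl)

∗-emp-elim : ∀ φ → (φ `∗ emp) ⊫ φ
∗-emp-elim φ = entails λ s h (h₁ , h₂ , split , p , empty) →
  ⊨-resp-≐ φ s (λ l → sym (Split.off-left h h₂ h₁ (Split.swap h h₁ h₂ split) (empty l))) p

∗-mono-left : ∀ {φ χ} ψ → φ ⊫ χ → (φ `∗ ψ) ⊫ (χ `∗ ψ)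
∗-mono-left ψ φ⊫χ = entails λ s h (h₁ , h₂ , split , p , q) → h₁ , h₂ , split , apply φ⊫χ s h₁ p , q

Monotone : Form → Set
Monotone φ = ∀ s h h₁ h₂ → h ≔ h₁ + h₂ → s , h₁ ⊨ φ → s , h ⊨ φ

monotone-∗ : ∀ φ ψ → Monotone φ → (φ `∗ ψ) ⊫ φ
monotone-∗ φ ψ mono = entails λ s h (h₁ , h₂ , split , p , _) → mono s h h₁ h₂ split p

equal-monotone : ∀ x y → Monotone (x `= y)
equal-monotone x y s h h₁ h₂ split p = p

unequal-monotone : ∀ x y → Monotone (`¬ (x `= y))
unequal-monotone x y s h h₁ h₂ split p = p

alloc-monotone : ∀ x → Monotone (alloc x)
alloc-monotone x s h h₁ h₂ split (v , e) = v , Split.left h h₁ h₂ split e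

points-to-monotone : ∀ x y → Monotone (x ↪ y)
points-to-monotone x y s h h₁ h₂ split = Split.left h h₁ h₂ split

nonempty-monotone : Monotone (`¬ emp)
nonempty-monotone s h h₁ h₂ split nonempty = nonempty ∘ Split.empty-left h h₁ h₂ split

dangling-monotone : ∀ x y → Monotone (alloc x `∧ `¬ (x ↪ y))
dangling-monotone x y s h h₁ h₂ split ((v , e) , ¬x↪y) =
  (v , left e) , λ x↪y → ¬x↪y (trans e (trans (sym (left e)) x↪y))
  where open Split h h₁ h₂ split

points-to⇒alloc : ∀ x y → (x ↪ y) ⊫ alloc x
points-to⇒alloc x y = entails λ s h e → s y , e

points-to-functional : ∀ x y z → ((x ↪ y) `∧ (x ↪ z)) ⊫ (y `= z)
points-to-functional x y z = entails λ s h (e₁ , e₂) → Maybe.just-injective (trans (sym e₁) e₂)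

alloc-∗-alloc : ∀ x → (alloc x `∗ alloc x) ⊫ `⊥
alloc-∗-alloc x = entails λ s h (h₁ , h₂ , split , (v , e) , a₂) _ →
  alloc⇒defined a₂ (Split.disjoint h h₁ h₂ split e)

unalloc-∗-unalloc : ∀ x → (`¬ alloc x `∗ `¬ alloc x) ⊫ `¬ alloc x
unalloc-∗-unalloc x = entails λ s h (h₁ , h₂ , split , ¬a₁ , ¬a₂) (v , e) →
  Sum.[ (λ e₁ → ¬a₁ (v , e₁)) , (λ e₂ → ¬a₂ (v , e₂)) ]′ (Split.cases h h₁ h₂ split e)

dangling-∗ : ∀ x y → ((alloc x `∧ `¬ (x ↪ y)) `∗ `⊤) ⊫ `¬ (x ↪ y)
dangling-∗ x y = entails λ s h p →
  proj₂ (apply (monotone-∗ (alloc x `∧ `¬ (x ↪ y)) `⊤ (dangling-monotone x y)) s h p)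

module Rename (s : Store) {x y : PVar} (x≈y : s x ≡ s y) where

  var : ∀ z → s (renameVar y x z) ≡ s z
  var z with z ≟ y
  ... | yes refl = x≈y
  ... | no _     = refl

  sound    : ∀ φ h → s , h ⊨ φ → s , h ⊨ replace y x φ
  complete : ∀ φ h → s , h ⊨ replace y x φ → s , h ⊨ φ

  sound (a `= b)  h p       = trans (var a) (trans p (sym (var b)))
  sound (a ↪ b)   h p       = subst₂ (λ i j → h ⟨ i ⟩ ≡ just j) (sym (var a)) (sym (var b)) p
  sound emp       h p       = p
  sound (alloc a) h p       = subst (Alloc h) (sym (var a)) p
  sound (`¬ φ)    h ¬p q    = ¬p (complete φ h q)
  sound (φ `∧ ψ)  h (p , q) = sound φ h p , sound ψ h q
  sound (φ `∗ ψ)  h (h₁ , h₂ , split , p , q) = h₁ , h₂ , split , sound φ h₁ p , sound ψ h₂ q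

  complete (a `= b)  h p       = trans (sym (var a)) (trans p (var b))
  complete (a ↪ b)   h p       = subst₂ (λ i j → h ⟨ i ⟩ ≡ just j) (var a) (var b) p
  complete emp       h p       = p
  complete (alloc a) h p       = subst (Alloc h) (var a) p
  complete (`¬ φ)    h ¬p q    = ¬p (sound φ h q)
  complete (φ `∧ ψ)  h (p , q) = complete φ h p , complete ψ h q
  complete (φ `∗ ψ)  h (h₁ , h₂ , split , p , q) = h₁ , h₂ , split , complete φ h₁ p , complete ψ h₂ q

replace-sound : ∀ φ x y → (φ `∧ (x `= y)) ⊫ replace y x φ
replace-sound φ x y = entails λ s h (p , x≈y) → Rename.sound s x≈y φ h p

AtLeast : ℕ → Heap → Set
AtLeast n h = Σ (List Loc) λ L → Unique L × n ≤ length L × All (Alloc h) L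

AtLeast-≤ : ∀ {m n} h → m ≤ n → AtLeast n h → AtLeast m h
AtLeast-≤ h m≤n (L , u , n≤ , allocated) = L , u , ≤-trans m≤n n≤ , allocated

AtLeast-∗ : ∀ {m n} h h₁ h₂ → h ≔ h₁ + h₂ → AtLeast m h₁ → AtLeast n h₂ → AtLeast (m + n) h
AtLeast-∗ h h₁ h₂ split (L₁ , u₁ , m≤ , a₁) (L₂ , u₂ , n≤ , a₂) =
  L₁ ++ L₂ , Unique.++⁺ u₁ u₂ apart ,
  subst (_ ≤_) (sym (length-++ L₁)) (+-mono-≤ m≤ n≤) ,
  All.++⁺ (All.map (λ (v , e) → v , left e) a₁) (All.map (λ (v , e) → v , right e) a₂)
  where
  open Split h h₁ h₂ split
  right : ∀ {l v} → h₂ ⟨ l ⟩ ≡ just v → h ⟨ l ⟩ ≡ just v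
  right = Split.left h h₂ h₁ swap
  apart : Disjoint L₁ L₂
  apart (l∈₁ , l∈₂) = alloc⇒defined (All.lookup a₂ l∈₂) (disjoint (proj₂ (All.lookup a₁ l∈₁)))

length-partition : {A : Set} {P : A → Set} (P? : ∀ x → Dec (P x)) (xs : List A) →
                   length (filter P? xs) + length (filter (¬? ∘ P?) xs) ≡ length xs
length-partition P? []       = refl
length-partition P? (x ∷ xs) with does (P? x)
... | true  = cong suc (length-partition P? xs)
... | false = trans (+-suc _ _) (cong suc (length-partition P? xs))

AtLeast-split : ∀ {n} h h₁ h₂ → h ≔ h₁ + h₂ → AtLeast n h →
                ∃₂ λ a b → n ≤ a + b × AtLeast a h₁ × AtLeast b h₂
AtLeast-split h h₁ h₂ split (L , u , n≤ , allocated) =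
  length L₁ , length L₂ ,
  subst (_ ≤_) (sym (length-partition (alloc? h₁) L)) n≤ ,
  (L₁ , Unique.filter⁺ (alloc? h₁) u , ≤-refl , All.all-filter (alloc? h₁) L) ,
  (L₂ , Unique.filter⁺ (¬? ∘ alloc? h₁) u , ≤-refl ,
   All.zipWith in-h₂ (All.all-filter (¬? ∘ alloc? h₁) L , All.filter⁺ (¬? ∘ alloc? h₁) allocated))
  where
  L₁ L₂ : List Loc
  L₁ = filter (alloc? h₁) L
  L₂ = filter (¬? ∘ alloc? h₁) L
  in-h₂ : ∀ {l} → ¬ Alloc h₁ l × Alloc h l → Alloc h₂ l
  in-h₂ (¬a₁ , (v , e)) = Sum.[ (λ e₁ → ⊥-elim (¬a₁ (v , e₁))) , (λ e₂ → v , e₂) ]′ (Split.cases h h₁ h₂ split e)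

allocated⇒AtLeast1 : ∀ h l → Alloc h l → AtLeast 1 h
allocated⇒AtLeast1 h l a = (l ∷ []) , ([] ∷ []) , s≤s z≤n , (a ∷ [])

size≥⇒AtLeast : ∀ n s h → s , h ⊨ size≥ n → AtLeast n h
size≥⇒AtLeast zero          s h _ = [] , [] , z≤n , []
size≥⇒AtLeast (suc zero)    s h nonempty =
  let (l , a) = nonempty⇒allocated h nonempty in allocated⇒AtLeast1 h l a
size≥⇒AtLeast (suc (suc β)) s h (h₁ , h₂ , split , nonempty , rest) =
  AtLeast-∗ h h₁ h₂ split (size≥⇒AtLeast 1 s h₁ nonempty) (size≥⇒AtLeast (suc β) s h₂ rest)

cell-alloc : ∀ h l → Alloc h l → Alloc (restrict h (l ∷ [])) l
cell-alloc h l (v , e) = v , trans (restrict-∈ h (l ∷ []) (here refl)) e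

remove-cell : ∀ h l {L} → All (l ≢_) L → All (Alloc h) L → All (Alloc (restrictᶜ h (l ∷ []))) L
remove-cell h l l∉L allocated = All.zipWith keep (l∉L , allocated)
  where
  keep : ∀ {m} → l ≢ m × Alloc h m → Alloc (restrictᶜ h (l ∷ [])) m
  keep (l≢m , (v , e)) = v , trans (restrictᶜ-∉ h (l ∷ []) λ { (here m≡l) → l≢m (sym m≡l) }) e

-- AtLeast n h implies size ≥ n: split off the first counted cell and recurse.
AtLeast⇒size≥ : ∀ n s h → AtLeast n h → s , h ⊨ size≥ n
AtLeast⇒size≥ zero          s h _ = λ ¬refl → ¬refl refl
AtLeast⇒size≥ (suc zero)    s h ([] , _ , () , _)
AtLeast⇒size≥ (suc zero)    s h (l ∷ _ , _ , _ , a ∷ _) = allocated⇒nonempty h l a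
AtLeast⇒size≥ (suc (suc β)) s h ([] , _ , () , _)
AtLeast⇒size≥ (suc (suc β)) s h (l ∷ L , l∉L ∷ u , s≤s β≤ , a ∷ allocated) =
  restrict h (l ∷ []) , restrictᶜ h (l ∷ []) , restrict-split h (l ∷ []) ,
  allocated⇒nonempty (restrict h (l ∷ [])) l (cell-alloc h l a) ,
  AtLeast⇒size≥ (suc β) s (restrictᶜ h (l ∷ [])) (L , u , β≤ , remove-cell h l l∉L allocated)

cell-size : ∀ s h l → Alloc h l → s , restrict h (l ∷ []) ⊨ size≡ 1
cell-size s h l a = allocated⇒nonempty cell l (cell-alloc h l a) , no-two ∘ size≥⇒AtLeast 2 s cell
  where
  cell : Heap
  cell = restrict h (l ∷ [])
  only-l : ∀ {m} → Alloc cell m → m ≡ l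
  only-l a′ with here m≡l ← restrict-alloc h (l ∷ []) a′ = m≡l
  no-two : ¬ AtLeast 2 cell
  no-two (_ ∷ [] , _ , s≤s () , _)
  no-two (m ∷ m′ ∷ _ , (m≢m′ ∷ _) ∷ _ , _ , aₘ ∷ aₘ′ ∷ _) = m≢m′ (trans (only-l aₘ) (sym (only-l aₘ′)))

size≥-antitone : ∀ β → size≥ (suc β) ⊫ size≥ β
size≥-antitone β = entails λ s h p → AtLeast⇒size≥ β s h (AtLeast-≤ h (n≤1+n β) (size≥⇒AtLeast (suc β) s h p))

alloc⇒cell : ∀ x → alloc x ⊫ ((alloc x `∧ size≡ 1) `∗ `⊤)
alloc⇒cell x = entails λ s h a →
  restrict h (s x ∷ []) , restrictᶜ h (s x ∷ []) , restrict-split h (s x ∷ []) ,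
  (cell-alloc h (s x) a , cell-size s h (s x) a) , λ ¬refl → ¬refl refl

nonempty⇒cell : `¬ emp ⊫ (size≡ 1 `∗ `⊤)
nonempty⇒cell = entails λ s h nonempty →
  let (l , a) = nonempty⇒allocated h nonempty in
  restrict h (l ∷ []) , restrictᶜ h (l ∷ []) , restrict-split h (l ∷ []) , cell-size s h l a , λ ¬refl → ¬refl refl

sum-bound : ∀ a b β₁ β₂ → suc a ≤ β₁ → suc b ≤ β₂ → ¬ (β₁ + β₂ ∸ 1 ≤ a + b)
sum-bound a b (suc β₁) (suc β₂) (s≤s a≤) (s≤s b≤) bound =
  n≮n (β₁ + β₂) (subst (_≤ β₁ + β₂) (+-suc β₁ β₂) (≤-trans bound (+-mono-≤ a≤ b≤)))

small-∗-small : ∀ β₁ β₂ → (`¬ size≥ β₁ `∗ `¬ size≥ β₂) ⊫ `¬ size≥ (β₁ + β₂ ∸ 1)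
small-∗-small β₁ β₂ = entails λ s h (h₁ , h₂ , split , small₁ , small₂) big →
  let (a , b , n≤ , at₁ , at₂) = AtLeast-split h h₁ h₂ split (size≥⇒AtLeast _ s h big) in
  sum-bound a b β₁ β₂ (≰⇒> λ β₁≤a → small₁ (AtLeast⇒size≥ β₁ s h₁ (AtLeast-≤ h₁ β₁≤a at₁)))
                      (≰⇒> λ β₂≤b → small₂ (AtLeast⇒size≥ β₂ s h₂ (AtLeast-≤ h₂ β₂≤b at₂))) n≤

two-allocated : ∀ x y → (alloc x `∧ alloc y `∧ `¬ (x `= y)) ⊫ size≥ 2
two-allocated x y = entails λ s h (aₓ , a_y , x≢y) →
  AtLeast⇒size≥ 2 s h ((s x ∷ s y ∷ []) , ((x≢y ∷ []) ∷ [] ∷ []) , s≤s (s≤s z≤n) , (aₓ ∷ a_y ∷ []))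

map-unique-on : ∀ {A B : Set} (f : A → B) {X : List A} → Unique X →
                (∀ {x y} → x ∈ X → y ∈ X → x ≢ y → f x ≢ f y) → Unique (map f X)
map-unique-on f {[]}    []          injective = []
map-unique-on f {x ∷ X} (x∉X ∷ u) injective =
  All.map⁺ (All.tabulate λ y∈X → injective (here refl) (there y∈X) (All.lookup x∉X y∈X)) ∷
  map-unique-on f u λ x∈ y∈ → injective (there x∈) (there y∈)

⋀-All : ∀ s h fs → s , h ⊨ ⋀ fs → All (λ φ → s , h ⊨ φ) fs
⋀-All s h []       _       = []
⋀-All s h (f ∷ fs) (p , ps) = p ∷ ⋀-All s h fs ps

distinct-alloc : ∀ X → Unique X → distinctAlloc X ⊫ size≥ (length X)
distinct-alloc X u = entails λ s h p →
  let conjuncts = All.map⁻ (⋀-All s h _ p)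
      separated : ∀ {x y} → x ∈ X → y ∈ X → x ≢ y → s x ≢ s y
      separated {x} x∈ y∈ x≢y =
        All.lookup (All.map⁻ (⋀-All s h _ (proj₂ (All.lookup conjuncts x∈))))
                   (∈-filter⁺ (λ z → ¬? (z ≟ x)) y∈ (x≢y ∘ sym))
  in AtLeast⇒size≥ (length X) s h
       (map s X , map-unique-on s u separated , ≤-reflexive (sym (length-map s X)) ,
        All.map⁺ (All.map proj₁ conjuncts))

-- Under the valuation that reads off the truth of each σ n, a propositional
-- formula evaluates to the decided truth of its instance.
module Tautology-instance (σ : ℕ → Form) (s : Store) (h : Heap) where

  truth : ℕ → Bool
  truth n = does (⊨-dec (σ n) s h)

  eval-instP : ∀ p → evalP truth p ≡ does (⊨-dec (instP σ p) s h)
  eval-instP (atom n) = refl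
  eval-instP (p¬ p)   = cong not (eval-instP p)
  eval-instP (p∧ p q) = cong₂ _∧_ (eval-instP p) (eval-instP q)

-- Instances of propositional tautologies are valid, as satisfaction is decidable.
tautology-valid : ∀ p → Tautology p → ∀ σ → Valid (instP σ p)
tautology-valid p tautology σ s h =
  does-true (⊨-dec (instP σ p) s h) (trans (sym (eval-instP p)) (tautology truth))
  where open Tautology-instance σ s h

lemma5p1 : (φ : Form) → Derivable φ → Valid φ
lemma5p1 _ (taut p t σ)          = tautology-valid p t σ
lemma5p1 ψ (mp {φ} d₁ d₂) s h    = apply (⇒-entails φ ψ (lemma5p1 _ d₂)) s h (lemma5p1 φ d₁ s h)
lemma5p1 _ (ax1 x) s h           = refl
lemma5p1 _ (ax2 φ x y)           = valid-⇒ (replace-sound φ x y)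
lemma5p1 _ (ax3 x y)             = valid-⇒ (points-to⇒alloc x y)
lemma5p1 _ (ax4 x y z)           = valid-⇒ (points-to-functional x y z)
lemma5p1 _ (ax5 β)               = valid-⇒ (size≥-antitone β)
lemma5p1 _ (ax6 X u)             = valid-⇒ (distinct-alloc X u)
lemma5p1 _ (ax7 φ ψ)             = valid-⇔ (∗-comm φ ψ) (∗-comm ψ φ)
lemma5p1 _ (ax8 φ ψ χ)           = valid-⇔ (∗-assoc φ ψ χ) (∗-assoc⁻¹ φ ψ χ)
lemma5p1 _ (ax9 φ ψ χ)           = valid-⇒ (∗-distrib-∨ φ ψ χ)
lemma5p1 _ (ax10 φ)              = valid-⇔ (⊥-∗ φ) (ex-falso (`⊥ `∗ φ))
lemma5p1 _ (ax11 φ)              = valid-⇔ (∗-emp-intro φ) (∗-emp-elim φ)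
lemma5p1 _ (ax12 x)              = valid-⇒ (monotone-∗ (alloc x) `⊤ (alloc-monotone x))
lemma5p1 _ (ax13 x)              = valid-⇔ (alloc-∗-alloc x) (ex-falso (alloc x `∗ alloc x))
lemma5p1 _ ax14a                 = valid-⇒ (monotone-∗ (`¬ emp) `⊤ nonempty-monotone)
lemma5p1 _ (ax14b x y)           = valid-⇒ (monotone-∗ (x `= y) `⊤ (equal-monotone x y))
lemma5p1 _ (ax14c x y)           = valid-⇒ (monotone-∗ (`¬ (x `= y)) `⊤ (unequal-monotone x y))
lemma5p1 _ (ax14d x y)           = valid-⇒ (monotone-∗ (x ↪ y) `⊤ (points-to-monotone x y))
lemma5p1 _ (ax15 x)              = valid-⇒ (unalloc-∗-unalloc x)
lemma5p1 _ (ax16 x y)            = valid-⇒ (dangling-∗ x y)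
lemma5p1 _ (ax17 x)              = valid-⇒ (alloc⇒cell x)
lemma5p1 _ ax18                  = valid-⇒ nonempty⇒cell
lemma5p1 _ (ax19 β₁ β₂)          = valid-⇒ (small-∗-small β₁ β₂)
lemma5p1 _ (ax20 x y)            = valid-⇒ (two-allocated x y)
lemma5p1 _ (∗-intro {φ} {χ} ψ d) = valid-⇒ (∗-mono-left ψ (⇒-entails φ χ (lemma5p1 _ d)))
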